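{- Let $n$ be a positive integer, and let $X=\{x_1,\ldots,x_k\}$ be a set of positive integers with $x_i<\frac{n}{2}$ for all $i$. Let $m=\sum_{i=1}^k x_i$. If $n=tm$ for some positive integer $t$, then the collection of all paths in the cycle $C_n$ whose lengths belong to $X$ can be partitioned into $m$ full $C_n$-packings.
   Context: $C_n$ denotes the cycle with vertices $0,1,\dots,n-1$ and edges $\{i,i+1 \bmod n\}$. The length of a path is its number of edges; for $1\le x<n/2$, the paths of length $x$ in $C_n$ are the $n$ paths with edges $\{a,a+1\},\dots,\{a+x-1,a+x\}$ (mod $n$), $a=0,\dots,n-1$. A $C_n$-packing is a collection of pairwise edge-disjoint subgraphs of $C_n$; it is full if the total number of edges of its members is $n$ (i.e., it covers every edge of $C_n$ exactly once). -}

module Defs where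

open import Data.Nat using (ℕ; zero; suc; _+_; _*_; _<_; NonZero)
open import Data.Nat.DivMod using (_%_)
open import Data.Fin using (Fin; toℕ; zero; suc)
open import Data.Product using (Σ; ∃; _×_; _,_)
open import Relation.Binary.PropositionalEquality using (_≡_; _≢_)
open import Relation.Nullary using (¬_)
open import Relation.Nullary.Decidable using (⌊_⌋)
open import Data.Fin using (_≟_)
open import Data.Bool using (if_then_else_)

∑ : (k : ℕ) → (Fin k → ℕ) → ℕ
∑ zero    f = 0
∑ (suc k) f = f zero + ∑ k (λ i → f (suc i))

-- Edges of C_n are indexed by j : Fin n, edge j = {j, j+1 mod n}.
-- The path of length x starting at vertex a has edges {a+s, a+s+1}, s < x.
-- "edge j lies on the path of length x starting at a":
EdgeOnPath : (n : ℕ) .{{_ : NonZero n}} → (a : Fin n) (x : ℕ) (j : Fin n) → Set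
EdgeOnPath n a x j = Σ ℕ λ s → s < x × toℕ j ≡ (toℕ a + s) % n

-- The paths under consideration are indexed by pairs (i , a): the path of
-- length x i starting at vertex a.  An assignment  cls : Fin k → Fin n → Fin m
-- partitions this collection into m classes.
IsFullPacking : (n k m : ℕ) .{{_ : NonZero n}} (x : Fin k → ℕ)
                (cls : Fin k → Fin n → Fin m) (c : Fin m) → Set
IsFullPacking n k m x cls c =
  (∀ (i i' : Fin k) (a a' : Fin n) → cls i a ≡ c → cls i' a' ≡ c →
     ¬ (i ≡ i' × a ≡ a') → ∀ (j : Fin n) →
     ¬ (EdgeOnPath n a (x i) j × EdgeOnPath n a' (x i') j))
  × ∑ k (λ i → ∑ n (λ a → if ⌊ cls i a ≟ c ⌋ then x i else 0)) ≡ n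

-- Cut [0, m) into consecutive blocks [p_i, p_i + x_i) with p_i = x_1 + ... + x_(i-1), and put
-- the path of length x_i starting at a into class a - p_i (mod m).  Class c then consists of the
-- t paths of length x_i starting at c + p_i + j m (j < t) for each i; their edges are exactly the
-- edges e with e - c in the block of i modulo m, so together they cover every edge of C_(t m) once.
module Submission where

open import Defs
open import Data.Nat using (ℕ; _*_; _<_; _≤_; NonZero)
open import Data.Fin using (Fin)
open import Data.Product using (Σ)
open import Function.Definitions using (Injective)
open import Relation.Binary.PropositionalEquality using (_≡_)

open import Data.Bool using (if_then_else_; T?)
open import Data.Fin using (zero; suc; toℕ; _≟_)
open import Data.Fin.Properties using (toℕ<n; toℕ-injective; toℕ-fromℕ<)
open import Data.Nat using (zero; suc; _+_; _∸_; _≡ᵇ_; s≤s)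
open import Data.Nat.DivMod using (_%_; _mod_; m%n<n; m<n⇒m%n≡m; %-distribˡ-+; %-remove-+ˡ; [m+n]%n≡m%n; m∣n⇒o%n%m≡o%m)
open import Data.Nat.Divisibility using (∣-refl; m∣m*n; n∣m*n)
open import Data.Nat.Properties
  using (+-assoc; +-comm; +-identityʳ; +-suc; +-cancelˡ-≡; *-zeroʳ; *-distribˡ-+;
         m≤m+n; ≤-trans; <⇒≱; +-monoʳ-≤; +-monoʳ-<; ≡⇒≡ᵇ; ≡ᵇ⇒≡; m∸n+n≡m; m*n≢0⇒n≢0)
open import Data.Nat.Solver using (module +-*-Solver)
open import Data.Product using (_×_; _,_; proj₁; proj₂; map₁)
open import Function using (_∘_; _$_; mk⇔)
open import Relation.Binary.PropositionalEquality using (refl; sym; trans; cong; cong₂; subst; module ≡-Reasoning)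
open import Relation.Nullary using (¬_; contradiction)
open import Relation.Nullary.Decidable using (⌊_⌋; does-⇔; isYes≗does)

open ≡-Reasoning
open +-*-Solver using (solve; _:+_; _:=_)

∑-cong : ∀ k {f g : Fin k → ℕ} → (∀ i → f i ≡ g i) → ∑ k f ≡ ∑ k g
∑-cong zero    eq = refl
∑-cong (suc k) eq = cong₂ _+_ (eq zero) (∑-cong k (eq ∘ suc))

∑-zero : ∀ k → ∑ k (λ _ → 0) ≡ 0
∑-zero zero    = refl
∑-zero (suc k) = ∑-zero k

∑-*-distribˡ : ∀ k t (f : Fin k → ℕ) → ∑ k (λ i → t * f i) ≡ t * ∑ k f
∑-*-distribˡ zero    t f = sym (*-zeroʳ t)
∑-*-distribˡ (suc k) t f = begin
  t * f zero + ∑ k (λ i → t * f (suc i)) ≡⟨ cong (t * f zero +_) (∑-*-distribˡ k t (f ∘ suc)) ⟩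
  t * f zero + t * ∑ k (f ∘ suc)         ≡⟨ *-distribˡ-+ t (f zero) _ ⟨
  t * ∑ (suc k) f                        ∎

∑ℕ : ℕ → (ℕ → ℕ) → ℕ
∑ℕ n g = ∑ n (g ∘ toℕ)

∑ℕ-cong< : ∀ n {f g : ℕ → ℕ} → (∀ b → b < n → f b ≡ g b) → ∑ℕ n f ≡ ∑ℕ n g
∑ℕ-cong< n eq = ∑-cong n (λ i → eq (toℕ i) (toℕ<n i))

∑ℕ-+ : ∀ a b g → ∑ℕ (a + b) g ≡ ∑ℕ a g + ∑ℕ b (λ j → g (a + j))
∑ℕ-+ zero    b g = refl
∑ℕ-+ (suc a) b g = trans (cong (g 0 +_) (∑ℕ-+ a b (g ∘ suc))) (sym (+-assoc (g 0) _ _))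

∑ℕ-suc : ∀ n g → ∑ℕ (suc n) g ≡ ∑ℕ n g + g n
∑ℕ-suc zero    g = +-identityʳ (g 0)
∑ℕ-suc (suc n) g = trans (cong (g 0 +_) (∑ℕ-suc n (g ∘ suc))) (sym (+-assoc (g 0) _ _))

Periodic : ℕ → (ℕ → ℕ) → Set
Periodic m F = ∀ b → F (m + b) ≡ F b

∑ℕ-periodic : ∀ m t G → Periodic m G → ∑ℕ (t * m) G ≡ t * ∑ℕ m G
∑ℕ-periodic m zero    G per = refl
∑ℕ-periodic m (suc t) G per = begin
  ∑ℕ (m + t * m) G                     ≡⟨ ∑ℕ-+ m (t * m) G ⟩
  ∑ℕ m G + ∑ℕ (t * m) (λ j → G (m + j)) ≡⟨ cong (∑ℕ m G +_) (∑-cong (t * m) (per ∘ toℕ)) ⟩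
  ∑ℕ m G + ∑ℕ (t * m) G                 ≡⟨ cong (∑ℕ m G +_) (∑ℕ-periodic m t G per) ⟩
  ∑ℕ m G + t * ∑ℕ m G                   ∎

∑ℕ-rotate : ∀ m F → Periodic m F → ∀ r → ∑ℕ m (λ b → F (b + r)) ≡ ∑ℕ m F
∑ℕ-rotate m F per zero    = ∑-cong m (λ i → cong F (+-identityʳ (toℕ i)))
∑ℕ-rotate m F per (suc r) = +-cancelˡ-≡ (F r) _ _ (begin
  F r + ∑ℕ m (λ b → F (b + suc r))  ≡⟨ cong (F r +_) (∑-cong m (λ i → cong F (+-suc (toℕ i) r))) ⟩
  ∑ℕ (suc m) (λ b → F (b + r))      ≡⟨ ∑ℕ-suc m (λ b → F (b + r)) ⟩
  ∑ℕ m (λ b → F (b + r)) + F (m + r) ≡⟨ cong₂ _+_ (∑ℕ-rotate m F per r) (per r) ⟩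
  ∑ℕ m F + F r                      ≡⟨ +-comm (∑ℕ m F) (F r) ⟩
  F r + ∑ℕ m F                      ∎)

∑ℕ-indicator : ∀ {m c} y → c < m → ∑ℕ m (λ b → if b ≡ᵇ c then y else 0) ≡ y
∑ℕ-indicator {suc m} {zero}  y _         = trans (cong (y +_) (∑-zero m)) (+-identityʳ y)
∑ℕ-indicator {suc m} {suc c} y (s≤s c<m) = ∑ℕ-indicator y c<m

∑ℕ-residue : ∀ t m .{{_ : NonZero m}} r {c} y → c < m →
             ∑ℕ (t * m) (λ b → if (b + r) % m ≡ᵇ c then y else 0) ≡ t * y
∑ℕ-residue t m r {c} y c<m = begin
  ∑ℕ (t * m) (λ b → H (b + r)) ≡⟨ ∑ℕ-periodic m t _ (λ b → trans (cong H (+-assoc m b r)) (H-periodic (b + r))) ⟩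
  t * ∑ℕ m (λ b → H (b + r))   ≡⟨ cong (t *_) (∑ℕ-rotate m H H-periodic r) ⟩
  t * ∑ℕ m H                   ≡⟨ cong (t *_) (∑ℕ-cong< m (λ b b<m → cong select (m<n⇒m%n≡m b<m))) ⟩
  t * ∑ℕ m select              ≡⟨ cong (t *_) (∑ℕ-indicator y c<m) ⟩
  t * y                        ∎
  where
  select : ℕ → ℕ
  select b = if b ≡ᵇ c then y else 0
  H : ℕ → ℕ
  H b = select (b % m)
  H-periodic : Periodic m H
  H-periodic b = cong select (%-remove-+ˡ b ∣-refl)

⌊≟⌋≡toℕ≡ᵇ : ∀ {m} (u v : Fin m) → ⌊ u ≟ v ⌋ ≡ (toℕ u ≡ᵇ toℕ v)
⌊≟⌋≡toℕ≡ᵇ u v = trans (isYes≗does (u ≟ v)) $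
  does-⇔ (mk⇔ (≡⇒≡ᵇ _ _ ∘ cong toℕ) (toℕ-injective ∘ ≡ᵇ⇒≡ _ _)) (u ≟ v) (T? _)

+-congˡ-mod : ∀ w {u v} d .{{_ : NonZero d}} → u % d ≡ v % d → (w + u) % d ≡ (w + v) % d
+-congˡ-mod w {u} {v} d eq = begin
  (w + u) % d         ≡⟨ %-distribˡ-+ w u d ⟩
  (w % d + u % d) % d ≡⟨ cong (λ z → (w % d + z) % d) eq ⟩
  (w % d + v % d) % d ≡⟨ %-distribˡ-+ w v d ⟨
  (w + v) % d         ∎

+-congʳ-mod : ∀ {u v} w d .{{_ : NonZero d}} → u % d ≡ v % d → (u + w) % d ≡ (v + w) % d
+-congʳ-mod {u} {v} w d eq = begin
  (u + w) % d ≡⟨ cong (_% d) (+-comm u w) ⟩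
  (w + u) % d ≡⟨ +-congˡ-mod w d eq ⟩
  (w + v) % d ≡⟨ cong (_% d) (+-comm w v) ⟩
  (v + w) % d ∎

-- Adding (d - 1) w turns the common summand w into the multiple d w.
+-cancelˡ-mod : ∀ w {u v} d .{{_ : NonZero d}} → (w + u) % d ≡ (w + v) % d → u % d ≡ v % d
+-cancelˡ-mod w {u} {v} d@(suc d-1) eq = begin
  u % d                   ≡⟨ %-remove-+ˡ u (m∣m*n w) ⟨
  (d * w + u) % d         ≡⟨ cong (_% d) (regroup u) ⟩
  (d-1 * w + (w + u)) % d ≡⟨ +-congˡ-mod (d-1 * w) d eq ⟩
  (d-1 * w + (w + v)) % d ≡⟨ cong (_% d) (regroup v) ⟨
  (d * w + v) % d         ≡⟨ %-remove-+ˡ v (m∣m*n w) ⟩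
  v % d                   ∎
  where
  regroup : ∀ z → d * w + z ≡ d-1 * w + (w + z)
  regroup z = trans (cong (_+ z) (+-comm w (d-1 * w))) (+-assoc (d-1 * w) w z)

+-cancelʳ-mod : ∀ {u v} w d .{{_ : NonZero d}} → (u + w) % d ≡ (v + w) % d → u % d ≡ v % d
+-cancelʳ-mod {u} {v} w d eq = +-cancelˡ-mod w d (begin
  (w + u) % d ≡⟨ cong (_% d) (+-comm w u) ⟩
  (u + w) % d ≡⟨ eq ⟩
  (v + w) % d ≡⟨ cong (_% d) (+-comm v w) ⟩
  (w + v) % d ∎)

prefixSum : ∀ {k} → (Fin k → ℕ) → Fin k → ℕ
prefixSum x zero    = 0
prefixSum x (suc i) = x zero + prefixSum (x ∘ suc) i

prefixSum+x≤∑ : ∀ {k} (x : Fin k → ℕ) i → prefixSum x i + x i ≤ ∑ k x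
prefixSum+x≤∑ x zero    = m≤m+n (x zero) _
prefixSum+x≤∑ x (suc i) =
  subst (_≤ ∑ _ x) (sym (+-assoc (x zero) _ _)) (+-monoʳ-≤ (x zero) (prefixSum+x≤∑ (x ∘ suc) i))

prefixSum-tiling : ∀ {k} (x : Fin k → ℕ) {i i' s s'} → s < x i → s' < x i' →
                   prefixSum x i + s ≡ prefixSum x i' + s' → i ≡ i' × s ≡ s'
prefixSum-tiling x {zero}  {zero}   _   _    eq = refl , eq
prefixSum-tiling x {zero}  {suc i'} s<x _    eq =
  contradiction (subst (x zero ≤_) (sym eq) (≤-trans (m≤m+n (x zero) _) (m≤m+n _ _))) (<⇒≱ s<x)
prefixSum-tiling x {suc i} {zero}   _   s'<x eq =
  contradiction (subst (x zero ≤_) eq (≤-trans (m≤m+n (x zero) _) (m≤m+n _ _))) (<⇒≱ s'<x)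
prefixSum-tiling x {suc i} {suc i'} {s} {s'} s<x s'<x eq =
  map₁ (cong suc) (prefixSum-tiling (x ∘ suc) s<x s'<x (+-cancelˡ-≡ (x zero) _ _ eq′))
  where
  eq′ : x zero + (prefixSum (x ∘ suc) i + s) ≡ x zero + (prefixSum (x ∘ suc) i' + s')
  eq′ = trans (sym (+-assoc (x zero) _ s)) (trans eq (+-assoc (x zero) _ s'))

module PathClasses {k : ℕ} (x : Fin k → ℕ) (t : ℕ) .{{_ : NonZero (t * ∑ k x)}} where

  m n : ℕ
  m = ∑ k x
  n = t * m

  instance
    m≢0 : NonZero m
    m≢0 = m*n≢0⇒n≢0 t

  offset : Fin k → ℕ
  offset i = m ∸ prefixSum x i

  classOf : Fin k → Fin n → Fin m
  classOf i a = (toℕ a + offset i) mod m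

  toℕ-classOf : ∀ i a → toℕ (classOf i a) ≡ (toℕ a + offset i) % m
  toℕ-classOf i a = toℕ-fromℕ< (m%n<n (toℕ a + offset i) m)

  offset+prefixSum : ∀ i → offset i + prefixSum x i ≡ m
  offset+prefixSum i = m∸n+n≡m (≤-trans (m≤m+n (prefixSum x i) (x i)) (prefixSum+x≤∑ x i))

  slot<m : ∀ i {s} → s < x i → prefixSum x i + s < m
  slot<m i s<x = ≤-trans (+-monoʳ-< (prefixSum x i) s<x) (prefixSum+x≤∑ x i)

  residue-shift : ∀ i A s → (A + offset i + (prefixSum x i + s)) % m ≡ (A + s) % m
  residue-shift i A s = begin
    (A + offset i + (prefixSum x i + s)) % m ≡⟨ cong (_% m) (regroup A (offset i) (prefixSum x i) s) ⟩
    (A + s + (offset i + prefixSum x i)) % m ≡⟨ cong (λ z → (A + s + z) % m) (offset+prefixSum i) ⟩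
    (A + s + m) % m                          ≡⟨ [m+n]%n≡m%n (A + s) m ⟩
    (A + s) % m                              ∎
    where
    regroup : ∀ A r p s → A + r + (p + s) ≡ A + s + (r + p)
    regroup = solve 4 (λ A r p s → A :+ r :+ (p :+ s) := A :+ s :+ (r :+ p)) refl

  same-class⇒same-slot : ∀ i i' a a' {s s'} → classOf i a ≡ classOf i' a' →
                         (toℕ a + s) % m ≡ (toℕ a' + s') % m →
                         (prefixSum x i + s) % m ≡ (prefixSum x i' + s') % m
  same-class⇒same-slot i i' a a' {s} {s'} same edge = +-cancelˡ-mod X m (begin
    (X + U) % m       ≡⟨ residue-shift i (toℕ a) s ⟩
    (toℕ a + s) % m   ≡⟨ edge ⟩
    (toℕ a' + s') % m ≡⟨ residue-shift i' (toℕ a') s' ⟨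
    (X' + U') % m     ≡⟨ +-congʳ-mod U' m X'≡X ⟩
    (X + U') % m      ∎)
    where
    X X' U U' : ℕ
    X = toℕ a + offset i
    X' = toℕ a' + offset i'
    U = prefixSum x i + s
    U' = prefixSum x i' + s'
    X'≡X : X' % m ≡ X % m
    X'≡X = trans (sym (toℕ-classOf i' a')) (trans (cong toℕ (sym same)) (toℕ-classOf i a))

  pairwiseDisjoint : ∀ c (i i' : Fin k) (a a' : Fin n) → classOf i a ≡ c → classOf i' a' ≡ c →
                     ¬ (i ≡ i' × a ≡ a') → ∀ (j : Fin n) →
                     ¬ (EdgeOnPath n a (x i) j × EdgeOnPath n a' (x i') j)
  pairwiseDisjoint c i i' a a' refl same distinct j ((s , s<x , j≡) , (s' , s'<x , j≡')) =
    distinct (proj₁ tiled , same-start (proj₂ tiled))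
    where
    edge : (toℕ a + s) % n ≡ (toℕ a' + s') % n
    edge = trans (sym j≡) j≡'
    edge-mod-m : (toℕ a + s) % m ≡ (toℕ a' + s') % m
    edge-mod-m = begin
      (toℕ a + s) % m       ≡⟨ m∣n⇒o%n%m≡o%m m n _ (n∣m*n t) ⟨
      (toℕ a + s) % n % m   ≡⟨ cong (_% m) edge ⟩
      (toℕ a' + s') % n % m ≡⟨ m∣n⇒o%n%m≡o%m m n _ (n∣m*n t) ⟩
      (toℕ a' + s') % m     ∎
    slot≡ : prefixSum x i + s ≡ prefixSum x i' + s'
    slot≡ = begin
      prefixSum x i + s         ≡⟨ m<n⇒m%n≡m (slot<m i s<x) ⟨
      (prefixSum x i + s) % m   ≡⟨ same-class⇒same-slot i i' a a' (sym same) edge-mod-m ⟩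
      (prefixSum x i' + s') % m ≡⟨ m<n⇒m%n≡m (slot<m i' s'<x) ⟩
      prefixSum x i' + s'       ∎
    tiled : i ≡ i' × s ≡ s'
    tiled = prefixSum-tiling x s<x s'<x slot≡
    same-start : s ≡ s' → a ≡ a'
    same-start refl = toℕ-injective (begin
      toℕ a      ≡⟨ m<n⇒m%n≡m (toℕ<n a) ⟨
      toℕ a % n  ≡⟨ +-cancelʳ-mod s n edge ⟩
      toℕ a' % n ≡⟨ m<n⇒m%n≡m (toℕ<n a') ⟩
      toℕ a'     ∎)

  classSize : ∀ c i → ∑ n (λ a → if ⌊ classOf i a ≟ c ⌋ then x i else 0) ≡ t * x i
  classSize c i = trans (∑-cong n (cong (if_then x i else 0) ∘ sameClass))
                        (∑ℕ-residue t m (offset i) (x i) (toℕ<n c))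
    where
    sameClass : ∀ a → ⌊ classOf i a ≟ c ⌋ ≡ ((toℕ a + offset i) % m ≡ᵇ toℕ c)
    sameClass a = trans (⌊≟⌋≡toℕ≡ᵇ (classOf i a) c) (cong (_≡ᵇ toℕ c) (toℕ-classOf i a))

  isFullPacking : ∀ c → IsFullPacking n k m x classOf c
  isFullPacking c = pairwiseDisjoint c , trans (∑-cong k (classSize c)) (∑-*-distribˡ k t x)

-- Distinctness of the x i and the bounds x i ≥ 1, 2 x i < n, t ≥ 1 are not needed: paths are
-- indexed by (i , a) rather than identified with their edge sets.
lemma2 : (n : ℕ) .{{_ : NonZero n}} (k : ℕ) (x : Fin k → ℕ) →
         Injective _≡_ _≡_ x →
         (∀ i → 1 ≤ x i) → (∀ i → 2 * x i < n) →
         (t : ℕ) → 1 ≤ t → n ≡ t * ∑ k x →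
         Σ (Fin k → Fin n → Fin (∑ k x))
           λ cls → ∀ c → IsFullPacking n k (∑ k x) x cls c
lemma2 .(t * ∑ k x) k x _ _ _ t _ refl = classOf , isFullPacking
  where open PathClasses x t
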